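{- Let $n\ge 2$. For each $1\le j\le n-1$, the permutation $x=x_1\cdots x_{2n}$ given by $x_1=1$; $x_i=2n-j+i-2$ for $2\le i\le j+1$; $x_i=i$ for $j+2\le i\le 2n-j-1$; $x_i=j+i-2n+2$ for $2n-j\le i\le 2n-1$; and $x_{2n}=2n$, belongs to $\mathsf{Pop}_{\mathrm{Weak}(B_n)}(\mathrm{Weak}(B_n))$.
   Context: $B_n$ is the set of permutations $x=x_1\cdots x_{2n}$ of $\{1,\dots,2n\}$ with $x_i+x_{2n+1-i}=2n+1$ for all $i$; $\mathrm{Weak}(B_n)$ is $B_n$ with the right weak order ($x\le y$ iff every pair of values $a<b$ with $b$ before $a$ in $x$ also has $b$ before $a$ in $y$). For a finite lattice $M$, $\mathsf{Pop}_M(x)$ is the meet of $x$ and all elements it covers; in $\mathrm{Weak}(B_n)$ this amounts to reversing each maximal descending run of $x$; $\mathsf{Pop}_M(M)$ denotes its image. -}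

module Defs where

open import Data.Nat using (ℕ; zero; suc; _+_; _*_; _∸_; _≤_; _<_; _≤ᵇ_; _≡ᵇ_)
open import Data.Fin using (Fin; toℕ; opposite)
open import Data.Product using (Σ; ∃; _×_; _,_)
open import Data.Sum using (_⊎_)
open import Data.Bool using (if_then_else_)
open import Relation.Nullary using (¬_)
open import Relation.Binary.PropositionalEquality using (_≡_)

-- A "word" of length 2n: position p (0-indexed, p : Fin (2n)) ↦ value x_{p+1} ∈ ℕ.
Word : ℕ → Set
Word n = Fin (2 * n) → ℕ

IsPerm : (n : ℕ) → Word n → Set
IsPerm n x = (∀ p → 1 ≤ x p × x p ≤ 2 * n) × (∀ p q → x p ≡ x q → p ≡ q)

-- The mirror position of p (0-indexed): 2n-1-p, i.e. 1-indexed i ↦ 2n+1-i.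
mirror : (n : ℕ) → Fin (2 * n) → Fin (2 * n)
mirror n = opposite

IsB : (n : ℕ) → Word n → Set
IsB n x = IsPerm n x × (∀ p → x p + x (mirror n p) ≡ suc (2 * n))

Before : (n : ℕ) → Word n → ℕ → ℕ → Set
Before n x b a = Σ (Fin (2 * n)) λ p → Σ (Fin (2 * n)) λ q →
  toℕ p < toℕ q × x p ≡ b × x q ≡ a

WeakLe : (n : ℕ) → Word n → Word n → Set
WeakLe n x y = ∀ a b → a < b → Before n x b a → Before n y b a

SameW : (n : ℕ) → Word n → Word n → Set
SameW n x y = ∀ p → x p ≡ y p

Covers : (n : ℕ) → Word n → Word n → Set
Covers n y w = WeakLe n w y × ¬ (SameW n w y) ×
  (∀ z → IsB n z → WeakLe n w z → WeakLe n z y → SameW n z w ⊎ SameW n z y)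

LowerBoundPop : (n : ℕ) → Word n → Word n → Set
LowerBoundPop n y z = WeakLe n z y × (∀ w → IsB n w → Covers n y w → WeakLe n z w)

IsPop : (n : ℕ) → Word n → Word n → Set
IsPop n y z = IsB n z × LowerBoundPop n y z ×
  (∀ u → IsB n u → LowerBoundPop n y u → WeakLe n u z)

InPopImage : (n : ℕ) → Word n → Set
InPopImage n z = Σ (Word n) λ y → IsB n y × IsPop n y z

-- The explicit permutation, as a function of the 1-indexed position i.
xVal : ℕ → ℕ → ℕ → ℕ
xVal n j i =
  if i ≤ᵇ 1 then 1
  else if i ≤ᵇ j + 1 then (2 * n ∸ j) + i ∸ 2
  else if i ≤ᵇ 2 * n ∸ j ∸ 1 then i
  else if i ≤ᵇ 2 * n ∸ 1 then j + i + 2 ∸ 2 * n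
  else 2 * n

xPerm : (n j : ℕ) → Word n
xPerm n j p = xVal n j (suc (toℕ p))

{-# OPTIONS --safe #-}
module Submission where

-- Let y be x with each of its three increasing blocks x_1 ⋯ x_{j+1}, x_{j+2} ⋯ x_{2n-j-1} and
-- x_{2n-j} ⋯ x_{2n} reversed. Then y ∈ B_n, and its maximal descending runs are exactly these
-- blocks, since at each junction y reads 1 followed by a larger value or a value followed by 2n.
-- So x is the reversal of the descending runs of y, and x = Pop(y) follows from the general fact,
-- proved here from the definitions: the elements covered by y are obtained by swapping one adjacent
-- descent of y together with its mirror image; x lies below all of them because these descents lie
-- inside runs, while a common lower bound of y and its covers keeps every descent inside a run
-- inverted, hence lies below x.

open import Defs
open import Data.Nat using (ℕ; zero; suc; _+_; _*_; _∸_; _≤_; _<_; _≤ᵇ_; _≡ᵇ_; z≤n; s≤s; pred; >-nonZero)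
open import Data.Nat.Properties
open import Data.Nat.Tactic.RingSolver using (solve-∀)
open import Data.Fin using (Fin; toℕ; fromℕ<; opposite; punchOut)
import Data.Fin.Properties as Fin
open import Data.Product using (∃; _×_; _,_; proj₁; proj₂)
open import Data.Sum using (_⊎_; inj₁; inj₂; [_,_]′)
open import Data.Empty using (⊥-elim)
open import Data.Bool using (Bool; true; false; if_then_else_; T)
open import Relation.Nullary using (¬_; yes; no)
open import Relation.Binary.PropositionalEquality
open import Relation.Binary using (tri<; tri≈; tri>)
open import Function using (_∘_)

if-true : ∀ {A : Set} {b : Bool} {x y : A} → b ≡ true → (if b then x else y) ≡ x
if-true refl = refl

if-false : ∀ {A : Set} {b : Bool} {x y : A} → b ≡ false → (if b then x else y) ≡ y
if-false refl = refl

≡ᵇ≡true⇒≡ : ∀ {m k} → (m ≡ᵇ k) ≡ true → m ≡ k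
≡ᵇ≡true⇒≡ {m} {k} eq = ≡ᵇ⇒≡ m k (subst T (sym eq) _)

≡ᵇ≡false⇒≢ : ∀ {m k} → (m ≡ᵇ k) ≡ false → m ≢ k
≡ᵇ≡false⇒≢ {m} {k} eq m≡k = subst T eq (≡⇒≡ᵇ m k m≡k)

≤⇒≤ᵇ≡true : ∀ {m k} → m ≤ k → (m ≤ᵇ k) ≡ true
≤⇒≤ᵇ≡true {m} {k} m≤k with m ≤ᵇ k in eq
... | true = refl
... | false = ⊥-elim (subst T eq (≤⇒≤ᵇ m≤k))

>⇒≤ᵇ≡false : ∀ {m k} → k < m → (m ≤ᵇ k) ≡ false
>⇒≤ᵇ≡false {m} {k} k<m with m ≤ᵇ k in eq
... | true = ⊥-elim (<⇒≱ k<m (≤ᵇ⇒≤ m k (subst T (sym eq) _)))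
... | false = refl

+-∸-inverse : ∀ a {b c} → a + b ≡ c → c ∸ a ≡ b
+-∸-inverse a {b} refl = m+n∸m≡n a b

≤⇒∃+ : ∀ {m k} → m ≤ k → ∃ λ d → m + d ≡ k
≤⇒∃+ {m} {k} m≤k = k ∸ m , m+[n∸m]≡n m≤k

complement-unique : ∀ k {a b N} → suc (k + a) ≡ N → suc (k + b) ≡ N → a ≡ b
complement-unique k e₁ e₂ = +-cancelˡ-≡ k _ _ (suc-injective (trans e₁ (sym e₂)))

odd≢even : ∀ a b → suc (a + a) ≢ b + b
odd≢even a b eq = even≢odd b a (trans (cong (b +_) (+-identityʳ b))
  (trans (sym eq) (cong (suc ∘ (a +_)) (sym (+-identityʳ a)))))

-- A self-map of a finite set missing a value factors injectively through a smaller one.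
Fin-injective⇒surjective : ∀ {k} (f : Fin k → Fin k) → (∀ a b → f a ≡ f b → a ≡ b) →
  ∀ v → ∃ λ p → f p ≡ v
Fin-injective⇒surjective {suc k} f inj v with Fin.any? (λ p → f p Fin.≟ v)
... | yes hit = hit
... | no miss = ⊥-elim (1+n≰n (Fin.injective⇒≤ {f = g} g-injective))
  where
  g : Fin (suc k) → Fin k
  g p = punchOut {i = v} {j = f p} (λ e → miss (p , sym e))
  g-injective : ∀ {a b} → g a ≡ g b → a ≡ b
  g-injective {a} {b} e =
    inj a b (Fin.punchOut-injective (λ e′ → miss (a , sym e′)) (λ e′ → miss (b , sym e′)) e)

swapPairs : ℕ → ℕ → ℕ → ℕ
swapPairs t t′ k =
  if k ≡ᵇ t then suc k else if k ≡ᵇ t′ then suc k else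
  if k ≡ᵇ suc t then pred k else if k ≡ᵇ suc t′ then pred k else k

module SwapPairs (t t′ : ℕ) (t+1≢t′ : suc t ≢ t′) (t≢t′+1 : t ≢ suc t′) where

  σ : ℕ → ℕ
  σ = swapPairs t t′

  data Shape (k : ℕ) : Set where
    up : k ≡ t ⊎ k ≡ t′ → σ k ≡ suc k → Shape k
    down : k ≡ suc t ⊎ k ≡ suc t′ → suc (σ k) ≡ k → Shape k
    fixed : k ≢ t → k ≢ t′ → k ≢ suc t → k ≢ suc t′ → σ k ≡ k → Shape k

  private
    suc-pred≡ : ∀ {k m} → k ≡ suc m → suc (pred k) ≡ k
    suc-pred≡ refl = refl

  shape : ∀ k → Shape k
  shape k with k ≡ᵇ t in e₁
  ... | true = up (inj₁ (≡ᵇ≡true⇒≡ e₁)) (if-true e₁)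
  ... | false with k ≡ᵇ t′ in e₂
  ... | true = up (inj₂ (≡ᵇ≡true⇒≡ e₂)) (trans (if-false e₁) (if-true e₂))
  ... | false with k ≡ᵇ suc t in e₃
  ... | true = down (inj₁ (≡ᵇ≡true⇒≡ e₃))
    (trans (cong suc (trans (if-false e₁) (trans (if-false e₂) (if-true e₃)))) (suc-pred≡ (≡ᵇ≡true⇒≡ e₃)))
  ... | false with k ≡ᵇ suc t′ in e₄
  ... | true = down (inj₂ (≡ᵇ≡true⇒≡ e₄))
    (trans (cong suc (trans (if-false e₁) (trans (if-false e₂) (trans (if-false e₃) (if-true e₄)))))
      (suc-pred≡ (≡ᵇ≡true⇒≡ e₄)))
  ... | false = fixed (≡ᵇ≡false⇒≢ e₁) (≡ᵇ≡false⇒≢ e₂) (≡ᵇ≡false⇒≢ e₃) (≡ᵇ≡false⇒≢ e₄)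
    (trans (if-false e₁) (trans (if-false e₂) (trans (if-false e₃) (if-false e₄))))

  σ-t : σ t ≡ suc t
  σ-t with shape t
  ... | up _ e = e
  ... | down (inj₁ t≡t+1) _ = ⊥-elim (1+n≢n (sym t≡t+1))
  ... | down (inj₂ t≡t′+1) _ = ⊥-elim (t≢t′+1 t≡t′+1)
  ... | fixed t≢t _ _ _ _ = ⊥-elim (t≢t refl)

  σ-t′ : σ t′ ≡ suc t′
  σ-t′ with shape t′
  ... | up _ e = e
  ... | down (inj₁ t′≡t+1) _ = ⊥-elim (t+1≢t′ (sym t′≡t+1))
  ... | down (inj₂ t′≡t′+1) _ = ⊥-elim (1+n≢n (sym t′≡t′+1))
  ... | fixed _ t′≢t′ _ _ _ = ⊥-elim (t′≢t′ refl)

  σ-suc-t : σ (suc t) ≡ t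
  σ-suc-t with shape (suc t)
  ... | up (inj₁ t+1≡t) _ = ⊥-elim (1+n≢n t+1≡t)
  ... | up (inj₂ t+1≡t′) _ = ⊥-elim (t+1≢t′ t+1≡t′)
  ... | down _ e = suc-injective e
  ... | fixed _ _ t+1≢t+1 _ _ = ⊥-elim (t+1≢t+1 refl)

  σ-suc-t′ : σ (suc t′) ≡ t′
  σ-suc-t′ with shape (suc t′)
  ... | up (inj₁ t′+1≡t) _ = ⊥-elim (t≢t′+1 (sym t′+1≡t))
  ... | up (inj₂ t′+1≡t′) _ = ⊥-elim (1+n≢n t′+1≡t′)
  ... | down _ e = suc-injective e
  ... | fixed _ _ _ t′+1≢t′+1 _ = ⊥-elim (t′+1≢t′+1 refl)

  σ-involutive : ∀ k → σ (σ k) ≡ k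
  σ-involutive k with shape k
  ... | up (inj₁ refl) e = trans (cong σ e) σ-suc-t
  ... | up (inj₂ refl) e = trans (cong σ e) σ-suc-t′
  ... | down (inj₁ refl) e = trans (cong σ (suc-injective e)) σ-t
  ... | down (inj₂ refl) e = trans (cong σ (suc-injective e)) σ-t′
  ... | fixed _ _ _ _ e = trans (cong σ e) e

  σ-≤-suc : ∀ k → σ k ≤ suc k
  σ-≤-suc k with shape k
  ... | up _ e = ≤-reflexive e
  ... | down _ e = ≤-trans (n≤1+n _) (≤-trans (≤-reflexive e) (n≤1+n k))
  ... | fixed _ _ _ _ e = ≤-trans (≤-reflexive e) (n≤1+n k)

  ≤-suc-σ : ∀ k → k ≤ suc (σ k)
  ≤-suc-σ k with shape k
  ... | up _ e = ≤-trans (n≤1+n k) (≤-trans (n≤1+n _) (≤-reflexive (cong suc (sym e))))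
  ... | down _ e = ≤-reflexive (sym e)
  ... | fixed _ _ _ _ e = ≤-trans (≤-reflexive (sym e)) (n≤1+n _)

  σ≡suc⇒ : ∀ k → σ k ≡ suc k → k ≡ t ⊎ k ≡ t′
  σ≡suc⇒ k e with shape k
  ... | up c _ = c
  ... | down _ e′ = ⊥-elim (<-irrefl refl (≤-trans (n≤1+n (suc k)) (≤-reflexive (trans (cong suc (sym e)) e′))))
  ... | fixed _ _ _ _ e′ = ⊥-elim (1+n≢n (trans (sym e) e′))

  -- σ moves every point by at most one, so it can only invert adjacent pairs it moves up.
  σ-inversion : ∀ p q → p < q → σ q < σ p → (p ≡ t ⊎ p ≡ t′) × q ≡ suc p
  σ-inversion p q p<q σq<σp with q ≟ suc p
  ... | yes q≡p+1 = σ≡suc⇒ p (≤-antisym (σ-≤-suc p)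
        (≤-trans (s≤s (≤-pred (≤-trans (≤-reflexive (sym q≡p+1)) (≤-suc-σ q)))) σq<σp)) , q≡p+1
  ... | no q≢p+1 = ⊥-elim (<⇒≱ σq<σp (≤-trans (σ-≤-suc p)
        (≤-pred (≤-trans (≤∧≢⇒< p<q (q≢p+1 ∘ sym)) (≤-suc-σ q)))))

  module Mirror (N : ℕ) (t+t′ : suc (suc (t + t′)) ≡ N) where

    private
      t′+t : suc (suc (t′ + t)) ≡ N
      t′+t = trans (cong (suc ∘ suc) (+-comm t′ t)) t+t′

      t+[t′+1] : suc (t + suc t′) ≡ N
      t+[t′+1] = trans (cong suc (+-suc t t′)) t+t′

      t′+[t+1] : suc (t′ + suc t) ≡ N
      t′+[t+1] = trans (cong suc (+-suc t′ t)) t′+t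

      complement-unique′ : ∀ k {a b} → suc (a + k) ≡ N → suc (b + k) ≡ N → a ≡ b
      complement-unique′ k e₁ e₂ = +-cancelʳ-≡ k _ _ (suc-injective (trans e₁ (sym e₂)))

    σ-mirror : ∀ k k′ → suc (k + k′) ≡ N → suc (σ k + σ k′) ≡ N
    σ-mirror k k′ e with shape k
    ... | up (inj₁ refl) e₁ = trans (cong₂ (λ a b → suc (a + b)) e₁
          (trans (cong σ (complement-unique t e t+[t′+1])) σ-suc-t′)) t+t′
    ... | up (inj₂ refl) e₁ = trans (cong₂ (λ a b → suc (a + b)) e₁
          (trans (cong σ (complement-unique t′ e t′+[t+1])) σ-suc-t)) t′+t
    ... | down (inj₁ refl) e₁ = trans (cong₂ (λ a b → suc (a + b)) (suc-injective e₁)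
          (trans (cong σ (complement-unique (suc t) e t+t′)) σ-t′)) t+[t′+1]
    ... | down (inj₂ refl) e₁ = trans (cong₂ (λ a b → suc (a + b)) (suc-injective e₁)
          (trans (cong σ (complement-unique (suc t′) e t′+t)) σ-t)) t′+[t+1]
    ... | fixed k≢t k≢t′ k≢t+1 k≢t′+1 e₁ with shape k′
    ...   | up (inj₁ refl) _ = ⊥-elim (k≢t′+1 (complement-unique′ t e t′+t))
    ...   | up (inj₂ refl) _ = ⊥-elim (k≢t+1 (complement-unique′ t′ e t+t′))
    ...   | down (inj₁ refl) _ = ⊥-elim (k≢t′ (complement-unique′ (suc t) e t′+[t+1]))
    ...   | down (inj₂ refl) _ = ⊥-elim (k≢t (complement-unique′ (suc t′) e t+[t′+1]))
    ...   | fixed _ _ _ _ e₂ = trans (cong₂ (λ a b → suc (a + b)) e₁ e₂) e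

module Words (n : ℕ) where

  private
    N : ℕ
    N = 2 * n
    Pos : Set
    Pos = Fin N

  toℕ<⇒≢ : ∀ {P Q : Pos} → toℕ P < toℕ Q → P ≢ Q
  toℕ<⇒≢ P<Q refl = <-irrefl refl P<Q

  Before-asym : ∀ {w a b} → IsPerm n w → Before n w b a → ¬ Before n w a b
  Before-asym (_ , inj) (p , q , p<q , refl , refl) (p′ , q′ , p′<q′ , wp′ , wq′)
    with inj p q′ (sym wq′) | inj q p′ (sym wp′)
  ... | refl | refl = <-asym p<q p′<q′

  Before-trans : ∀ {w a b c} → IsPerm n w → Before n w c b → Before n w b a → Before n w c a
  Before-trans (_ , inj) (p , q , p<q , wp , refl) (p′ , q′ , p′<q′ , wp′ , wq′)
    with inj q p′ (sym wp′)
  ... | refl = p , q′ , <-trans p<q p′<q′ , wp , wq′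

  Before-cong : ∀ {z w a b} → SameW n z w → Before n w b a → Before n z b a
  Before-cong z≈w (p , q , p<q , wp , wq) = p , q , p<q , trans (z≈w p) wp , trans (z≈w q) wq

  IsPerm-surjective : ∀ {w} → IsPerm n w → ∀ v → 1 ≤ v → v ≤ N → ∃ λ p → w p ≡ v
  IsPerm-surjective {w} (range , inj) v 1≤v v≤N
    with Fin-injective⇒surjective index index-injective (fromℕ< (pred< 1≤v v≤N))
    where
    pred< : ∀ {u} → 1 ≤ u → u ≤ N → pred u < N
    pred< {suc u} _ u≤N = u≤N
    index : Pos → Fin N
    index p = fromℕ< (pred< (proj₁ (range p)) (proj₂ (range p)))
    index-injective : ∀ a b → index a ≡ index b → a ≡ b
    index-injective a b e = inj a b (pred-injective {{>-nonZero (proj₁ (range a))}} {{>-nonZero (proj₁ (range b))}}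
      (trans (sym (Fin.toℕ-fromℕ< _)) (trans (cong toℕ e) (Fin.toℕ-fromℕ< _))))
  ... | p , e = p , pred-injective {{>-nonZero (proj₁ (range p))}} {{>-nonZero 1≤v}}
      (trans (sym (Fin.toℕ-fromℕ< _)) (trans (cong toℕ e) (Fin.toℕ-fromℕ< _)))

  Before-total : ∀ {w y} → IsPerm n w → IsPerm n y → ∀ P Q → P ≢ Q →
                 Before n w (y Q) (y P) ⊎ Before n w (y P) (y Q)
  Before-total {w} {y} w-perm (range , inj) P Q P≢Q
    with IsPerm-surjective w-perm (y P) (proj₁ (range P)) (proj₂ (range P))
       | IsPerm-surjective w-perm (y Q) (proj₁ (range Q)) (proj₂ (range Q))
  ... | p , wp | q , wq with <-cmp (toℕ q) (toℕ p)
  ... | tri< q<p _ _ = inj₁ (q , p , q<p , wq , wp)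
  ... | tri≈ _ q≡p _ = ⊥-elim (P≢Q (inj P Q (trans (sym wp) (trans (cong w (Fin.toℕ-injective (sym q≡p))) wq))))
  ... | tri> _ _ p<q = inj₂ (p , q , p<q , wp , wq)

  toℕ-opposite-sum : ∀ (p : Pos) → suc (toℕ p + toℕ (opposite p)) ≡ N
  toℕ-opposite-sum p = trans (cong (suc (toℕ p) +_) (Fin.opposite-prop p)) (m+[n∸m]≡n (Fin.toℕ<n p))

  opposite-< : ∀ {p q : Pos} → toℕ p < toℕ q → toℕ (opposite q) < toℕ (opposite p)
  opposite-< {p} {q} p<q = subst₂ _<_ (sym (Fin.opposite-prop q)) (sym (Fin.opposite-prop p))
    (∸-monoʳ-< (s≤s p<q) (Fin.toℕ<n q))

  IsB-opposite : ∀ {w} → IsB n w → ∀ p → w (opposite p) ≡ suc N ∸ w p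
  IsB-opposite {w} (_ , w-sym) p = sym (trans (cong (_∸ w p) (sym (w-sym p))) (m+n∸m≡n (w p) _))

  Before-mirror : ∀ {w a b} → IsB n w → Before n w b a → Before n w (suc N ∸ a) (suc N ∸ b)
  Before-mirror wB (p , q , p<q , refl , refl) =
    opposite q , opposite p , opposite-< p<q , IsB-opposite wB q , IsB-opposite wB p

  IsB-∘ : ∀ {w} → IsB n w → (σ : Pos → Pos) → (∀ p → σ (σ p) ≡ p) →
          (∀ p → σ (opposite p) ≡ opposite (σ p)) → IsB n (w ∘ σ)
  IsB-∘ {w} ((range , inj) , w-sym) σ σσ σ-opposite =
    ((range ∘ σ) , λ p q e → trans (sym (σσ p)) (trans (cong σ (inj (σ p) (σ q) e)) (σσ q))) ,
    λ p → trans (cong (λ r → w (σ p) + w r) (σ-opposite p)) (w-sym (σ p))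

  value1-< : ∀ {w} → IsPerm n w → ∀ {p q} → w p ≡ 1 → p ≢ q → w p < w q
  value1-< {w} (range , inj) {p} {q} wp≡1 p≢q = subst (_< w q) (sym wp≡1)
    (≤∧≢⇒< (proj₁ (range q)) (λ 1≡wq → p≢q (inj p q (trans wp≡1 1≡wq))))

  <-valueN : ∀ {w} → IsPerm n w → ∀ {p q} → w q ≡ N → p ≢ q → w p < w q
  <-valueN {w} (range , inj) {p} {q} wq≡N p≢q = subst (w p <_) (sym wq≡N)
    (≤∧≢⇒< (proj₂ (range p)) (λ wp≡N → p≢q (inj p q (trans wp≡N (sym wq≡N)))))

  private
    firstDifference : ∀ {u v} → IsPerm n u → IsPerm n v → (p : Pos) →
      (∀ (p′ : Pos) → toℕ p′ < toℕ p → u p′ ≡ v p′) → u p ≢ v p → ∃ λ q → toℕ p < toℕ q × v q ≡ u p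
    firstDifference {u} {v} u-perm v-perm p agree u≢v
      with IsPerm-surjective v-perm (u p) (proj₁ (proj₁ u-perm p)) (proj₂ (proj₁ u-perm p))
    ... | q , vq≡up with <-cmp (toℕ q) (toℕ p)
    ... | tri< q<p _ _ = ⊥-elim (<-irrefl (cong toℕ (proj₂ u-perm q p (trans (agree q q<p) vq≡up))) q<p)
    ... | tri≈ _ q≡p _ = ⊥-elim (u≢v (sym (trans (cong v (sym (Fin.toℕ-injective q≡p))) vq≡up)))
    ... | tri> _ _ p<q = q , p<q , vq≡up

  -- At the first position p where u and v differ, the smaller of u p, v p comes later in the other
  -- word, giving an inversion of one word that the other lacks.
  WeakLe-antisym : ∀ {u v} → IsPerm n u → IsPerm n v → WeakLe n u v → WeakLe n v u → SameW n u v
  WeakLe-antisym {u} {v} u-perm v-perm u≤v v≤u p = agreeBelow (suc (toℕ p)) p ≤-refl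
    where
    agreeBelow : ∀ k (p : Pos) → toℕ p < k → u p ≡ v p
    agreeBelow (suc k) p (s≤s p≤k) with u p ≟ v p
    ... | yes up≡vp = up≡vp
    ... | no up≢vp
      with firstDifference u-perm v-perm p (λ p′ p′<p → agreeBelow k p′ (<-≤-trans p′<p p≤k)) up≢vp
         | firstDifference v-perm u-perm p (λ p′ p′<p → sym (agreeBelow k p′ (<-≤-trans p′<p p≤k))) (up≢vp ∘ sym)
    ... | q , p<q , vq≡up | r , p<r , ur≡vp with <-cmp (u p) (v p)
    ... | tri< up<vp _ _ = ⊥-elim (Before-asym u-perm (v≤u _ _ up<vp (p , q , p<q , refl , vq≡up))
                                                     (p , r , p<r , refl , ur≡vp))
    ... | tri≈ _ up≡vp _ = ⊥-elim (up≢vp up≡vp)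
    ... | tri> _ _ vp<up = ⊥-elim (Before-asym v-perm (u≤v _ _ vp<up (p , r , p<r , refl , ur≡vp))
                                                     (p , q , p<q , refl , vq≡up))

  -- Exchanging the entries at an adjacent descent t, t + 1 of y, and at its mirror image, gives
  -- an element of B_n covered by y; its inversions are those of y minus the two exchanged pairs.
  module AdjacentSwap (y : Word n) (yB : IsB n y) (t t₁ : Pos) (t₁≡t+1 : toℕ t₁ ≡ suc (toℕ t))
                      (descent : y t₁ < y t) where

    private
      t′ : ℕ
      t′ = toℕ (opposite t₁)

      t+t′ : suc (suc (toℕ t + t′)) ≡ N
      t+t′ = trans (cong (λ s → suc (s + t′)) (sym t₁≡t+1)) (toℕ-opposite-sum t₁)

      N≡n+n : ∀ {a} → a ≡ N → a ≡ n + n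
      N≡n+n e = trans e (cong (n +_) (+-identityʳ n))

      t+1≢t′ : suc (toℕ t) ≢ t′
      t+1≢t′ e = odd≢even (suc (toℕ t)) n (N≡n+n (subst (λ s → suc (suc (toℕ t + s)) ≡ N) (sym e) t+t′))

      t≢t′+1 : toℕ t ≢ suc t′
      t≢t′+1 e = odd≢even (suc t′) n (N≡n+n (trans (cong (suc ∘ suc) (+-suc t′ t′))
        (subst (λ s → suc (suc (s + t′)) ≡ N) e t+t′)))

    open SwapPairs (toℕ t) t′ t+1≢t′ t≢t′+1
    open Mirror N t+t′

    private
      σ-bounded : ∀ (p : Pos) → σ (toℕ p) < N
      σ-bounded p with shape (toℕ p)
      ... | up (inj₁ e) e′ = subst (_< N) (sym (trans e′ (trans (cong suc e) (sym t₁≡t+1)))) (Fin.toℕ<n t₁)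
      ... | up (inj₂ e) e′ = subst (_< N) (sym (trans e′ (cong suc e)))
                              (≤-trans (s≤s (s≤s (m≤n+m t′ (toℕ t)))) (≤-reflexive t+t′))
      ... | down _ e = ≤-trans (≤-reflexive e) (<⇒≤ (Fin.toℕ<n p))
      ... | fixed _ _ _ _ e = subst (_< N) (sym e) (Fin.toℕ<n p)

    abstract
      swap : Pos → Pos
      swap p = fromℕ< (σ-bounded p)

      toℕ-swap : ∀ p → toℕ (swap p) ≡ σ (toℕ p)
      toℕ-swap p = Fin.toℕ-fromℕ< _

    swap-involutive : ∀ p → swap (swap p) ≡ p
    swap-involutive p = Fin.toℕ-injective
      (trans (toℕ-swap (swap p)) (trans (cong σ (toℕ-swap p)) (σ-involutive (toℕ p))))

    swap-injective : ∀ {p q} → toℕ (swap p) ≡ toℕ (swap q) → p ≡ q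
    swap-injective {p} {q} e =
      trans (sym (swap-involutive p)) (trans (cong swap (Fin.toℕ-injective e)) (swap-involutive q))

    swap-opposite : ∀ p → swap (opposite p) ≡ opposite (swap p)
    swap-opposite p = Fin.toℕ-injective (trans (toℕ-swap (opposite p))
      (complement-unique (σ (toℕ p))
        (σ-mirror (toℕ p) (toℕ (opposite p)) (toℕ-opposite-sum p))
        (subst (λ s → suc (s + toℕ (opposite (swap p))) ≡ N) (toℕ-swap p) (toℕ-opposite-sum (swap p)))))

    swap-t : swap t ≡ t₁
    swap-t = Fin.toℕ-injective (trans (toℕ-swap t) (trans σ-t (sym t₁≡t+1)))

    swap-t₁ : swap t₁ ≡ t
    swap-t₁ = Fin.toℕ-injective (trans (toℕ-swap t₁) (trans (cong σ t₁≡t+1) σ-suc-t))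

    toℕ-opposite-t : toℕ (opposite t) ≡ suc t′
    toℕ-opposite-t = complement-unique (toℕ t) (toℕ-opposite-sum t) (trans (cong suc (+-suc (toℕ t) t′)) t+t′)

    SwapPair : Pos → Pos → Set
    SwapPair P Q = (P ≡ t × Q ≡ t₁) ⊎ (P ≡ opposite t₁ × Q ≡ opposite t)

    swap-inversion : ∀ {p q : Pos} → toℕ p < toℕ q → toℕ (swap q) < toℕ (swap p) → SwapPair p q
    swap-inversion {p} {q} p<q swap-q<swap-p
      with σ-inversion (toℕ p) (toℕ q) p<q (subst₂ _<_ (toℕ-swap q) (toℕ-swap p) swap-q<swap-p)
    ... | inj₁ p≡t , q≡p+1 = inj₁ (Fin.toℕ-injective p≡t ,
          Fin.toℕ-injective (trans q≡p+1 (trans (cong suc p≡t) (sym t₁≡t+1))))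
    ... | inj₂ p≡t′ , q≡p+1 = inj₂ (Fin.toℕ-injective p≡t′ ,
          Fin.toℕ-injective (trans q≡p+1 (trans (cong suc p≡t′) (sym toℕ-opposite-t))))

    swapped : Word n
    swapped = y ∘ swap

    swapped-IsB : IsB n swapped
    swapped-IsB = IsB-∘ yB swap swap-involutive swap-opposite

    mirror-descent : y (opposite t) < y (opposite t₁)
    mirror-descent = subst₂ _<_ (sym (IsB-opposite yB t)) (sym (IsB-opposite yB t₁))
      (∸-monoʳ-< descent (≤-trans (proj₂ (proj₁ (proj₁ yB) t)) (n≤1+n N)))

    Before-swapped⊎SwapPair : ∀ {P Q : Pos} → toℕ P < toℕ Q → Before n swapped (y P) (y Q) ⊎ SwapPair P Q
    Before-swapped⊎SwapPair {P} {Q} P<Q with <-cmp (toℕ (swap P)) (toℕ (swap Q))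
    ... | tri< lt _ _ = inj₁ (swap P , swap Q , lt , cong y (swap-involutive P) , cong y (swap-involutive Q))
    ... | tri≈ _ eq _ = ⊥-elim (toℕ<⇒≢ P<Q (swap-injective eq))
    ... | tri> _ _ gt = inj₂ (swap-inversion P<Q gt)

    SwapPair-inversion : ∀ {P Q} → SwapPair P Q → y Q < y P
    SwapPair-inversion (inj₁ (refl , refl)) = descent
    SwapPair-inversion (inj₂ (refl , refl)) = mirror-descent

    SwapPair-¬Before : ∀ {w} → IsB n w → Before n w (y t₁) (y t) → ∀ {P Q} → SwapPair P Q →
                       ¬ Before n w (y P) (y Q)
    SwapPair-¬Before wB b (inj₁ (refl , refl)) = Before-asym (proj₁ wB) b
    SwapPair-¬Before wB b (inj₂ (refl , refl)) = Before-asym (proj₁ wB)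
      (subst₂ (Before n _) (sym (IsB-opposite yB t)) (sym (IsB-opposite yB t₁)) (Before-mirror wB b))

    swapped≤y : WeakLe n swapped y
    swapped≤y c d c<d (p , q , p<q , refl , refl) with <-cmp (toℕ (swap p)) (toℕ (swap q))
    ... | tri< lt _ _ = swap p , swap q , lt , refl , refl
    ... | tri≈ _ eq _ = ⊥-elim (toℕ<⇒≢ p<q (swap-injective eq))
    ... | tri> _ _ gt = ⊥-elim (<-asym c<d (SwapPair-inversion (swap-inversion {swap q} {swap p} gt
          (subst₂ _<_ (sym (cong toℕ (swap-involutive p))) (sym (cong toℕ (swap-involutive q))) p<q))))

    swapped-ascent : Before n swapped (y t₁) (y t)
    swapped-ascent = t , t₁ , ≤-reflexive (sym t₁≡t+1) , cong y swap-t , cong y swap-t₁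

    swapped≢y : ¬ SameW n swapped y
    swapped≢y same = <-irrefl (trans (sym (cong y swap-t)) (same t)) descent

    ≤swapped : ∀ {w} → IsB n w → WeakLe n w y → Before n w (y t₁) (y t) → WeakLe n w swapped
    ≤swapped wB w≤y b c d c<d bw with w≤y c d c<d bw
    ... | P , Q , P<Q , refl , refl with Before-swapped⊎SwapPair P<Q
    ...   | inj₁ bz = bz
    ...   | inj₂ pair = ⊥-elim (SwapPair-¬Before wB b pair bw)

    y≤ : ∀ {u} → IsB n u → WeakLe n swapped u → Before n u (y t) (y t₁) → WeakLe n y u
    y≤ uB swapped≤u b c d c<d (P , Q , P<Q , refl , refl) with Before-swapped⊎SwapPair P<Q
    ... | inj₁ bz = swapped≤u _ _ c<d bz
    ... | inj₂ (inj₁ (refl , refl)) = b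
    ... | inj₂ (inj₂ (refl , refl)) =
      subst₂ (Before n _) (sym (IsB-opposite yB t₁)) (sym (IsB-opposite yB t)) (Before-mirror uB b)

    y-covers-swapped : Covers n y swapped
    y-covers-swapped = swapped≤y , swapped≢y , λ u uB swapped≤u u≤y →
      [ (λ b → inj₁ (WeakLe-antisym (proj₁ uB) (proj₁ swapped-IsB) (≤swapped uB u≤y b) swapped≤u))
      , (λ b → inj₂ (WeakLe-antisym (proj₁ uB) (proj₁ yB) u≤y (y≤ uB swapped≤u b))) ]′
      (Before-total (proj₁ uB) (proj₁ yB) t t₁ (toℕ<⇒≢ (≤-reflexive (sym t₁≡t+1))))

    cover-undoing-descent≈swapped : ∀ {w} → IsB n w → Covers n y w → Before n w (y t₁) (y t) →
                                    SameW n swapped w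
    cover-undoing-descent≈swapped wB (w≤y , _ , between) b
      with between swapped swapped-IsB (≤swapped wB w≤y b) swapped≤y
    ... | inj₁ swapped≈w = swapped≈w
    ... | inj₂ swapped≈y = ⊥-elim (swapped≢y swapped≈y)

    cover-undoes-only-SwapPairs : ∀ {w} → IsB n w → Covers n y w → Before n w (y t₁) (y t) →
      ∀ {P Q : Pos} → toℕ P < toℕ Q → Before n w (y Q) (y P) → SwapPair P Q
    cover-undoes-only-SwapPairs wB w-cover b P<Q b′ with Before-swapped⊎SwapPair P<Q
    ... | inj₁ bz = ⊥-elim (Before-asym (proj₁ swapped-IsB) bz
                      (Before-cong (cover-undoing-descent≈swapped wB w-cover b) b′))
    ... | inj₂ pair = pair

    SwapPair-adjacent : ∀ {P Q} → SwapPair P Q → toℕ Q ≡ suc (toℕ P)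
    SwapPair-adjacent (inj₁ (refl , refl)) = t₁≡t+1
    SwapPair-adjacent (inj₂ (refl , refl)) = toℕ-opposite-t

  nextPos : ∀ (P Q : Pos) → toℕ P < toℕ Q → ∃ λ R → toℕ R ≡ suc (toℕ P)
  nextPos P Q P<Q = fromℕ< (≤-<-trans P<Q (Fin.toℕ<n Q)) , Fin.toℕ-fromℕ< _

  module UndoneDescent {w y : Word n} (w-perm : IsPerm n w) (y-perm : IsPerm n y) (w≤y : WeakLe n w y) where

    UndoneAdjacentDescent : Set
    UndoneAdjacentDescent = ∃ λ t → ∃ λ t₁ → toℕ t₁ ≡ suc (toℕ t) × y t₁ < y t × Before n w (y t₁) (y t)

    undoneAdjacentDescent : ∀ d (P Q : Pos) → toℕ P < toℕ Q → toℕ Q ≤ d + toℕ P →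
      y Q < y P → Before n w (y Q) (y P) → UndoneAdjacentDescent
    throughNext : ∀ d (P R Q : Pos) → toℕ R ≡ suc (toℕ P) → toℕ R < toℕ Q → toℕ Q ≤ d + toℕ R →
      y Q < y P → Before n w (y Q) (y P) → UndoneAdjacentDescent

    undoneAdjacentDescent zero P Q P<Q Q≤P _ _ = ⊥-elim (<⇒≱ P<Q Q≤P)
    undoneAdjacentDescent (suc d) P Q P<Q Q≤d+1+P yQ<yP b with nextPos P Q P<Q
    ... | R , R≡P+1 with toℕ R ≟ toℕ Q
    ...   | yes R≡Q = P , Q , trans (sym R≡Q) R≡P+1 , yQ<yP , b
    ...   | no R≢Q = throughNext d P R Q R≡P+1 (≤∧≢⇒< (subst (_≤ toℕ Q) (sym R≡P+1) P<Q) R≢Q)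
            (≤-trans Q≤d+1+P (≤-reflexive (trans (sym (+-suc d (toℕ P))) (cong (d +_) (sym R≡P+1)))))
            yQ<yP b

    throughNext d P R Q R≡P+1 R<Q Q≤d+R yQ<yP b with <-cmp (y R) (y P)
    ... | tri≈ _ yR≡yP _ = ⊥-elim (toℕ<⇒≢ (≤-reflexive (sym R≡P+1)) (sym (proj₂ y-perm R P yR≡yP)))
    ... | tri< yR<yP _ _ with Before-total w-perm y-perm P R (toℕ<⇒≢ (≤-reflexive (sym R≡P+1)))
    ...   | inj₁ bRP = P , R , R≡P+1 , yR<yP , bRP
    ...   | inj₂ bPR with Before-total w-perm y-perm R Q (toℕ<⇒≢ R<Q)
    ...     | inj₂ bRQ = ⊥-elim (Before-asym w-perm (Before-trans w-perm bPR bRQ) b)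
    ...     | inj₁ bQR with <-cmp (y Q) (y R)
    ...       | tri< yQ<yR _ _ = undoneAdjacentDescent d R Q R<Q Q≤d+R yQ<yR bQR
    ...       | tri≈ _ yQ≡yR _ = ⊥-elim (toℕ<⇒≢ R<Q (proj₂ y-perm R Q (sym yQ≡yR)))
    ...       | tri> _ _ yR<yQ = ⊥-elim (Before-asym y-perm (w≤y _ _ yR<yQ bQR) (R , Q , R<Q , refl , refl))
    throughNext d P R Q R≡P+1 R<Q Q≤d+R yQ<yP b | tri> _ _ yP<yR
      with Before-total w-perm y-perm P R (toℕ<⇒≢ (≤-reflexive (sym R≡P+1)))
    ... | inj₁ bRP = ⊥-elim (Before-asym y-perm (w≤y _ _ yP<yR bRP) (P , R , ≤-reflexive (sym R≡P+1) , refl , refl))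
    ... | inj₂ bPR = undoneAdjacentDescent d R Q R<Q Q≤d+R (<-trans yQ<yP yP<yR) (Before-trans w-perm b bPR)

  cover-undoes-only-adjacent : ∀ {y w} → IsB n y → IsB n w → Covers n y w →
    ∀ {P Q : Pos} → toℕ P < toℕ Q → y Q < y P → Before n w (y Q) (y P) → toℕ Q ≡ suc (toℕ P)
  cover-undoes-only-adjacent {y} {w} yB wB w-cover@(w≤y , _) {P} {Q} P<Q yQ<yP b
    with UndoneDescent.undoneAdjacentDescent (proj₁ wB) (proj₁ yB) w≤y (toℕ Q) P Q P<Q (m≤m+n _ _) yQ<yP b
  ... | t , t₁ , t₁≡t+1 , descent , b′ = SwapPair-adjacent (cover-undoes-only-SwapPairs wB w-cover b′ P<Q b)
    where open AdjacentSwap y yB t t₁ t₁≡t+1 descent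

-- y = x ∘ ρ is cut into the runs p ↦ run p; ρ reverses each run, x ascends inside runs and y ascends
-- between them, so the runs are exactly the maximal descending runs of y and x is their reversal.
record RunReversal (n : ℕ) (x : Word n) : Set where
  field
    ρ : Fin (2 * n) → Fin (2 * n)
    ρ-involutive : ∀ p → ρ (ρ p) ≡ p
    ρ-opposite : ∀ p → ρ (opposite p) ≡ opposite (ρ p)
    run : Fin (2 * n) → ℕ
    run-monotone : ∀ {p q} → toℕ p ≤ toℕ q → run p ≤ run q
    run-ρ : ∀ p → run (ρ p) ≡ run p
    ρ-reverses-runs : ∀ {p q} → run p ≡ run q → toℕ (ρ p) + toℕ p ≡ toℕ (ρ q) + toℕ q
    ascending-in-runs : ∀ {p q} → toℕ q ≡ suc (toℕ p) → run p ≡ run q → x p < x q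
    ascending-between-runs : ∀ {p q} → toℕ q ≡ suc (toℕ p) → run p ≢ run q → x (ρ p) < x (ρ q)

module PopOfRunReversal {n : ℕ} {x : Word n} (xB : IsB n x) (R : RunReversal n x) where
  open RunReversal R
  open Words n

  private
    Pos : Set
    Pos = Fin (2 * n)

  y : Word n
  y = x ∘ ρ

  y-IsB : IsB n y
  y-IsB = IsB-∘ xB ρ ρ-involutive ρ-opposite

  ρ-reverses-order : ∀ {p q : Pos} → run p ≡ run q → toℕ p < toℕ q → toℕ (ρ q) < toℕ (ρ p)
  ρ-reverses-order same p<q = ≰⇒> (λ ρq≥ρp → <-irrefl (ρ-reverses-runs same) (+-mono-≤-< ρq≥ρp p<q))

  ρ-preserves-order : ∀ {p q : Pos} → run p ≢ run q → toℕ p < toℕ q → toℕ (ρ p) < toℕ (ρ q)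
  ρ-preserves-order {p} {q} differ p<q = ≰⇒> (λ ρq≤ρp → differ (≤-antisym (run-monotone (<⇒≤ p<q))
    (subst₂ _≤_ (run-ρ q) (run-ρ p) (run-monotone ρq≤ρp))))

  ρ-adjacent : ∀ {t t₁ : Pos} → toℕ t₁ ≡ suc (toℕ t) → run t ≡ run t₁ → toℕ (ρ t) ≡ suc (toℕ (ρ t₁))
  ρ-adjacent {t} {t₁} t₁≡t+1 same = +-cancelʳ-≡ (toℕ t) _ _
    (trans (ρ-reverses-runs same) (trans (cong (toℕ (ρ t₁) +_) t₁≡t+1) (+-suc (toℕ (ρ t₁)) (toℕ t))))

  descending-in-runs : ∀ {t t₁ : Pos} → toℕ t₁ ≡ suc (toℕ t) → run t ≡ run t₁ → y t₁ < y t
  descending-in-runs {t} {t₁} t₁≡t+1 same = ascending-in-runs (ρ-adjacent t₁≡t+1 same)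
    (trans (run-ρ t₁) (trans (sym same) (sym (run-ρ t))))

  descent⇒same-run : ∀ {t t₁ : Pos} → toℕ t₁ ≡ suc (toℕ t) → y t₁ < y t → run t ≡ run t₁
  descent⇒same-run {t} {t₁} t₁≡t+1 descent with run t ≟ run t₁
  ... | yes same = same
  ... | no differ = ⊥-elim (<-asym descent (ascending-between-runs t₁≡t+1 differ))

  along-runs : (Rel : Pos → Pos → Set) → (∀ {a b c} → Rel a b → Rel b c → Rel a c) →
               (∀ (P Q : Pos) → toℕ Q ≡ suc (toℕ P) → run P ≡ run Q → Rel P Q) →
               ∀ (P Q : Pos) → toℕ P < toℕ Q → run P ≡ run Q → Rel P Q
  along-runs Rel Rel-trans neighbours P Q P<Q same = go (toℕ Q) P Q P<Q (m≤m+n (toℕ Q) (toℕ P)) same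
    where
    go : ∀ d (P Q : Pos) → toℕ P < toℕ Q → toℕ Q ≤ d + toℕ P → run P ≡ run Q → Rel P Q
    go zero P Q P<Q Q≤P _ = ⊥-elim (<⇒≱ P<Q Q≤P)
    go (suc d) P Q P<Q Q≤d+1+P same with nextPos P Q P<Q
    ... | R , R≡P+1 with toℕ R ≟ toℕ Q
    ...   | yes R≡Q = neighbours P Q (trans (sym R≡Q) R≡P+1) same
    ...   | no R≢Q = Rel-trans (neighbours P R R≡P+1 sameR)
            (go d R Q R<Q (≤-trans Q≤d+1+P (≤-reflexive (trans (sym (+-suc d (toℕ P))) (cong (d +_) (sym R≡P+1)))))
              (trans (sym sameR) same))
      where
      R<Q : toℕ R < toℕ Q
      R<Q = ≤∧≢⇒< (subst (_≤ toℕ Q) (sym R≡P+1) P<Q) R≢Q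
      sameR : run P ≡ run R
      sameR = ≤-antisym (run-monotone (≤-trans (n≤1+n _) (≤-reflexive (sym R≡P+1))))
                        (≤-trans (run-monotone (<⇒≤ R<Q)) (≤-reflexive (sym same)))

  y∘ρ : ∀ p → y (ρ p) ≡ x p
  y∘ρ p = cong x (ρ-involutive p)

  x-inversions-between-runs : ∀ {p q : Pos} → toℕ p < toℕ q → x q < x p → run p ≢ run q
  x-inversions-between-runs {p} {q} p<q xq<xp same = <-asym xq<xp (subst₂ _<_ (y∘ρ p) (y∘ρ q)
    (along-runs (λ P Q → y Q < y P) (λ ab bc → <-trans bc ab) (λ _ _ → descending-in-runs) (ρ q) (ρ p)
      (ρ-reverses-order same p<q) (trans (run-ρ q) (trans (sym same) (sym (run-ρ p))))))

  x≤y : WeakLe n x y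
  x≤y a b a<b (p , q , p<q , refl , refl) =
    ρ p , ρ q , ρ-preserves-order (x-inversions-between-runs p<q a<b) p<q , y∘ρ p , y∘ρ q

  x≤covers : ∀ w → IsB n w → Covers n y w → WeakLe n x w
  x≤covers w wB w-cover a b a<b (p , q , p<q , refl , refl)
    with Before-total (proj₁ wB) (proj₁ xB) q p (toℕ<⇒≢ p<q ∘ sym)
  ... | inj₁ bw = bw
  ... | inj₂ bw = ⊥-elim (x-inversions-between-runs p<q a<b
        (trans (sym (run-ρ p)) (trans (descent⇒same-run adjacent yρq<yρp) (run-ρ q))))
    where
    yρq<yρp : y (ρ q) < y (ρ p)
    yρq<yρp = subst₂ _<_ (sym (y∘ρ q)) (sym (y∘ρ p)) a<b
    adjacent : toℕ (ρ q) ≡ suc (toℕ (ρ p))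
    adjacent = cover-undoes-only-adjacent y-IsB wB w-cover (ρ-preserves-order (x-inversions-between-runs p<q a<b) p<q)
      yρq<yρp (subst₂ (Before n w) (sym (y∘ρ q)) (sym (y∘ρ p)) bw)

  lowerBounds≤x : ∀ u → IsB n u → LowerBoundPop n y u → WeakLe n u x
  lowerBounds≤x u uB (u≤y , u≤covers) c d c<d b with u≤y c d c<d b
  ... | P , Q , P<Q , yP≡d , yQ≡c with run P ≟ run Q
  ...   | no differ = ρ P , ρ Q , ρ-preserves-order differ P<Q , yP≡d , yQ≡c
  ...   | yes same = ⊥-elim (Before-asym (proj₁ uB) (subst₂ (Before n u) (sym yP≡d) (sym yQ≡c) b)
          (along-runs (λ P Q → Before n u (y Q) (y P)) (λ ab bc → Before-trans (proj₁ uB) bc ab)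
            neighbours P Q P<Q same))
    where
    neighbours : ∀ (s s₁ : Pos) → toℕ s₁ ≡ suc (toℕ s) → run s ≡ run s₁ → Before n u (y s₁) (y s)
    neighbours s s₁ s₁≡s+1 same′
      with Before-total (proj₁ uB) (proj₁ y-IsB) s s₁ (toℕ<⇒≢ (≤-reflexive (sym s₁≡s+1)))
    ... | inj₁ b′ = b′
    ... | inj₂ b′ = ⊥-elim (Before-asym (proj₁ swapped-IsB)
          (u≤covers swapped swapped-IsB y-covers-swapped _ _ (descending-in-runs s₁≡s+1 same′) b′) swapped-ascent)
      where open AdjacentSwap y y-IsB s s₁ s₁≡s+1 (descending-in-runs s₁≡s+1 same′)

  InPopImage-of-RunReversal : InPopImage n x
  InPopImage-of-RunReversal = y , y-IsB , xB , (x≤y , x≤covers) , lowerBounds≤x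

-- Positions are 0-indexed: position k carries x_{k+1}. With n = j + m + 1 the three runs of
-- x ∘ ρ are the positions [0, j], [j + 1, j + 2m] and [j + 2m + 1, 2n - 1].
module Witness (j m : ℕ) where

  n : ℕ
  n = suc (j + m)

  M : ℕ
  M = m + m

  N : ℕ
  N = suc (suc (j + M + j))

  2n≡N : 2 * n ≡ N
  2n≡N = identity j m
    where
    identity : ∀ j m → 2 * suc (j + m) ≡ suc (suc (j + (m + m) + j))
    identity = solve-∀

  -- Region k records the offsets of k from the two ends of its run (k and a in the first run);
  -- rev and the mirror map exchange them.
  data Region (k : ℕ) : Set where
    first : ∀ a → k + a ≡ j → Region k
    middle : ∀ a b → k ≡ suc (j + a) → suc (a + b) ≡ M → Region k
    last : ∀ a b → k ≡ suc (j + M + a) → a + b ≡ j → Region k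

  region : ∀ k → k < N → Region k
  region k k<N with k ≤? j
  ... | yes k≤j = let (a , e) = ≤⇒∃+ k≤j in first a e
  ... | no k≰j with ≤⇒∃+ (≰⇒> k≰j)
  ...   | a , j+1+a≡k with k ≤? j + M
  ...     | yes k≤j+M = middle a _ (sym j+1+a≡k) (proj₂ (≤⇒∃+ (+-cancelˡ-≤ j _ _
                          (subst (_≤ j + M) (trans (sym j+1+a≡k) (sym (+-suc j a))) k≤j+M))))
  ...     | no k≰j+M with ≤⇒∃+ (≰⇒> k≰j+M)
  ...       | a′ , j+M+1+a′≡k = last a′ _ (sym j+M+1+a′≡k) (proj₂ (≤⇒∃+ (+-cancelˡ-≤ (j + M) _ _
                                  (≤-pred (≤-pred (subst (_< N) (sym j+M+1+a′≡k) k<N))))))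

  first<N : ∀ k {a} → k + a ≡ j → k < N
  first<N k {a} e = s≤s (≤-trans (subst (k ≤_) e (m≤m+n k a))
    (≤-trans (≤-trans (m≤m+n j (M + j)) (≤-reflexive (sym (+-assoc j M j)))) (n≤1+n _)))

  middle<N : ∀ {a b} → suc (a + b) ≡ M → suc (j + a) < N
  middle<N {a} {b} e = s≤s (s≤s (≤-trans (+-monoʳ-≤ j (≤-trans (m≤m+n a b) (≤-trans (n≤1+n _) (≤-reflexive e))))
    (m≤m+n (j + M) j)))

  last<N : ∀ {a b} → a + b ≡ j → suc (j + M + a) < N
  last<N {a} {b} e = s≤s (s≤s (+-monoʳ-≤ (j + M) (subst (a ≤_) e (m≤m+n a b))))

  first+last : ∀ k {a} → k + a ≡ j → suc (k + suc (j + M + a)) ≡ N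
  first+last k {a} e = trans (identity k a j M) (cong (λ s → suc (suc (j + M + s))) e)
    where
    identity : ∀ k a j M → suc (k + suc (j + M + a)) ≡ suc (suc (j + M + (k + a)))
    identity = solve-∀

  middle+middle : ∀ {a b} → suc (a + b) ≡ M → suc (suc (j + a) + suc (j + b)) ≡ N
  middle+middle {a} {b} e = trans (identity j a b) (cong (λ s → suc (suc (j + s + j))) e)
    where
    identity : ∀ j a b → suc (suc (j + a) + suc (j + b)) ≡ suc (suc (j + suc (a + b) + j))
    identity = solve-∀

  last+first : ∀ {a b} → a + b ≡ j → suc (suc (j + M + a) + b) ≡ N
  last+first {a} {b} e = trans (cong suc (+-comm (suc (j + M + a)) b)) (first+last b (trans (+-comm b a) e))

  mirror-first : ∀ k {a k′} → k + a ≡ j → suc (k + k′) ≡ N → k′ ≡ suc (j + M + a)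
  mirror-first k e e′ = complement-unique k e′ (first+last k e)

  mirror-middle : ∀ {a b k′} → suc (a + b) ≡ M → suc (suc (j + a) + k′) ≡ N → k′ ≡ suc (j + b)
  mirror-middle {a} e e′ = complement-unique (suc (j + a)) e′ (middle+middle e)

  mirror-last : ∀ {a b k′} → a + b ≡ j → suc (suc (j + M + a) + k′) ≡ N → k′ ≡ b
  mirror-last {a} e e′ = complement-unique (suc (j + M + a)) e′ (last+first e)

  run : ℕ → ℕ
  run k = if k ≤ᵇ j then 0 else if k ≤ᵇ j + M then 1 else 2

  run-monotone : ∀ {k k′} → k ≤ k′ → run k ≤ run k′
  run-monotone {k} {k′} k≤k′ with k ≤ᵇ j in e₁ | k′ ≤ᵇ j in e₁′
  ... | true | _ = z≤n
  ... | false | true = ⊥-elim (subst T e₁ (≤⇒≤ᵇ (≤-trans k≤k′ (≤ᵇ⇒≤ k′ j (subst T (sym e₁′) _)))))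
  ... | false | false with k ≤ᵇ j + M in e₂ | k′ ≤ᵇ j + M in e₂′
  ...   | true | true = ≤-refl
  ...   | true | false = s≤s z≤n
  ...   | false | true = ⊥-elim (subst T e₂ (≤⇒≤ᵇ (≤-trans k≤k′ (≤ᵇ⇒≤ k′ (j + M) (subst T (sym e₂′) _)))))
  ...   | false | false = ≤-refl

  run-first : ∀ k {a} → k + a ≡ j → run k ≡ 0
  run-first k {a} e = if-true (≤⇒≤ᵇ≡true (subst (k ≤_) e (m≤m+n k a)))

  run-middle : ∀ {a b} → suc (a + b) ≡ M → run (suc (j + a)) ≡ 1
  run-middle {a} {b} e = trans (if-false (>⇒≤ᵇ≡false (s≤s (m≤m+n j a))))
    (if-true (≤⇒≤ᵇ≡true (subst (_≤ j + M) (+-suc j a) (+-monoʳ-≤ j (subst (suc a ≤_) e (s≤s (m≤m+n a b)))))))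

  run-last : ∀ a → run (suc (j + M + a)) ≡ 2
  run-last a = trans (if-false (>⇒≤ᵇ≡false (s≤s (≤-trans (m≤m+n j M) (m≤m+n (j + M) a)))))
    (if-false (>⇒≤ᵇ≡false (s≤s (m≤m+n (j + M) a))))

  -- The sum of a position and its image under the reversal of its run.
  runSum : ℕ → ℕ
  runSum 0 = j
  runSum 1 = suc (j + j + M)
  runSum _ = suc (j + M) + suc (j + M + j)

  rev : ℕ → ℕ
  rev k = runSum (run k) ∸ k

  rev-first : ∀ k {a} → k + a ≡ j → rev k ≡ a
  rev-first k e = trans (cong (λ r → runSum r ∸ k) (run-first k e)) (+-∸-inverse k e)

  middle-sum : ∀ {a b} → suc (a + b) ≡ M → suc (j + a) + suc (j + b) ≡ runSum 1
  middle-sum {a} {b} e = trans (identity j a b) (cong (λ s → suc (j + j + s)) e)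
    where
    identity : ∀ j a b → suc (j + a) + suc (j + b) ≡ suc (j + j + suc (a + b))
    identity = solve-∀

  last-sum : ∀ {a b} → a + b ≡ j → suc (j + M + a) + suc (j + M + b) ≡ runSum 2
  last-sum {a} {b} e = trans (identity j M a b) (cong (λ s → suc (j + M) + suc (j + M + s)) e)
    where
    identity : ∀ j M a b → suc (j + M + a) + suc (j + M + b) ≡ suc (j + M) + suc (j + M + (a + b))
    identity = solve-∀

  rev-middle : ∀ {a b} → suc (a + b) ≡ M → rev (suc (j + a)) ≡ suc (j + b)
  rev-middle {a} e = trans (cong (λ r → runSum r ∸ suc (j + a)) (run-middle e))
    (+-∸-inverse (suc (j + a)) (middle-sum e))

  rev-last : ∀ {a b} → a + b ≡ j → rev (suc (j + M + a)) ≡ suc (j + M + b)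
  rev-last {a} e = trans (cong (λ r → runSum r ∸ suc (j + M + a)) (run-last a))
    (+-∸-inverse (suc (j + M + a)) (last-sum e))

  rev+id : ∀ k → k < N → rev k + k ≡ runSum (run k)
  rev+id k k<N with region k k<N
  ... | first a e = trans (cong (_+ k) (rev-first k e))
        (trans (+-comm a k) (trans e (cong runSum (sym (run-first k e)))))
  ... | middle a b refl e = trans (cong (_+ k) (rev-middle e))
        (trans (+-comm (suc (j + b)) k) (trans (middle-sum e) (cong runSum (sym (run-middle e)))))
  ... | last a b refl e = trans (cong (_+ k) (rev-last e))
        (trans (+-comm (suc (j + M + b)) k) (trans (last-sum e) (cong runSum (sym (run-last a)))))

  run-rev : ∀ k → k < N → run (rev k) ≡ run k
  run-rev k k<N with region k k<N
  ... | first a e = trans (cong run (rev-first k e))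
        (trans (run-first a (trans (+-comm a k) e)) (sym (run-first k e)))
  ... | middle a b refl e = trans (cong run (rev-middle e))
        (trans (run-middle (trans (cong suc (+-comm b a)) e)) (sym (run-middle e)))
  ... | last a b refl e = trans (cong run (rev-last e)) (trans (run-last b) (sym (run-last a)))

  rev-involutive : ∀ k → k < N → rev (rev k) ≡ k
  rev-involutive k k<N with region k k<N
  ... | first a e = trans (cong rev (rev-first k e)) (rev-first a (trans (+-comm a k) e))
  ... | middle a b refl e = trans (cong rev (rev-middle e)) (rev-middle (trans (cong suc (+-comm b a)) e))
  ... | last a b refl e = trans (cong rev (rev-last e)) (rev-last (trans (+-comm b a) e))

  rev<N : ∀ k → k < N → rev k < N
  rev<N k k<N with region k k<N
  ... | first a e = subst (_< N) (sym (rev-first k e)) (first<N a (trans (+-comm a k) e))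
  ... | middle a b refl e = subst (_< N) (sym (rev-middle e)) (middle<N (trans (cong suc (+-comm b a)) e))
  ... | last a b refl e = subst (_< N) (sym (rev-last e)) (last<N (trans (+-comm b a) e))

  rev-mirror : ∀ k k′ → k < N → suc (k + k′) ≡ N → suc (rev k + rev k′) ≡ N
  rev-mirror k k′ k<N mirror with region k k<N
  ... | first a e = trans (cong₂ (λ r r′ → suc (r + r′)) (rev-first k e)
          (trans (cong rev (mirror-first k e mirror)) (rev-last (trans (+-comm a k) e))))
        (first+last a (trans (+-comm a k) e))
  ... | middle a b refl e = trans (cong₂ (λ r r′ → suc (r + r′)) (rev-middle e)
          (trans (cong rev (mirror-middle e mirror)) (rev-middle (trans (cong suc (+-comm b a)) e))))
        (middle+middle (trans (cong suc (+-comm b a)) e))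
  ... | last a b refl e = trans (cong₂ (λ r r′ → suc (r + r′)) (rev-last e)
          (trans (cong rev (mirror-last e mirror)) (rev-first b (trans (+-comm b a) e))))
        (last+first (trans (+-comm b a) e))

  value : ℕ → ℕ
  value k = xVal n j (suc k)

  private
    2n∸j : 2 * n ∸ j ≡ suc (suc (j + M))
    2n∸j = trans (cong (_∸ j) 2n≡N) (+-∸-inverse j (identity j M))
      where
      identity : ∀ j M → j + suc (suc (j + M)) ≡ suc (suc (j + M + j))
      identity = solve-∀

    j+1< : ∀ {i} → suc (suc j) ≤ i → j + 1 < i
    j+1< {i} = subst (_< i) (+-comm 1 j)

    ≤j+1 : ∀ {i} → i ≤ suc j → i ≤ j + 1
    ≤j+1 {i} = subst (i ≤_) (+-comm 1 j)

    j+M+a≤j+M+j : ∀ {a b} → a + b ≡ j → j + M + a ≤ j + M + j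
    j+M+a≤j+M+j {a} {b} e = +-monoʳ-≤ (j + M) (subst (a ≤_) e (m≤m+n a b))

  value-first : ∀ k {a} → suc k + a ≡ j → value (suc k) ≡ suc (suc (j + M + k))
  value-first k {a} e = trans (if-true (≤⇒≤ᵇ≡true (≤j+1 (s≤s (subst (suc k ≤_) e (m≤m+n (suc k) a))))))
    (trans (cong (λ s → s + suc (suc k) ∸ 2) 2n∸j) (+-∸-inverse 2 (sym (identity j M k))))
    where
    identity : ∀ j M k → suc (suc (j + M)) + suc (suc k) ≡ 2 + suc (suc (j + M + k))
    identity = solve-∀

  value-middle : ∀ {a b} → suc (a + b) ≡ M → value (suc (j + a)) ≡ suc (suc (j + a))
  value-middle {a} {b} e = trans (if-false (>⇒≤ᵇ≡false (j+1< (s≤s (s≤s (m≤m+n j a))))))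
    (if-true (≤⇒≤ᵇ≡true (subst (suc (suc (j + a)) ≤_) (sym (cong (_∸ 1) 2n∸j))
      (s≤s (subst (_≤ j + M) (+-suc j a) (+-monoʳ-≤ j (subst (suc a ≤_) e (s≤s (m≤m+n a b)))))))))

  value-last : ∀ {a b} → a + suc b ≡ j → value (suc (j + M + a)) ≡ suc (suc a)
  value-last {a} {b} e = trans (if-false (>⇒≤ᵇ≡false (j+1< (s≤s (s≤s (≤-trans (m≤m+n j M) (m≤m+n (j + M) a)))))))
    (trans (if-false (>⇒≤ᵇ≡false (subst (_< suc (suc (j + M + a))) (sym (cong (_∸ 1) 2n∸j))
      (s≤s (s≤s (m≤m+n (j + M) a))))))
    (trans (if-true (≤⇒≤ᵇ≡true (subst (suc (suc (j + M + a)) ≤_) (sym (cong (_∸ 1) 2n≡N))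
      (s≤s (subst (_≤ j + M + j) (+-suc (j + M) a) (j+M+a≤j+M+j (trans (sym (+-suc a b)) e)))))))
    (trans (cong (λ s → j + suc (suc (j + M + a)) + 2 ∸ s) 2n≡N)
      (+-∸-inverse N (sym (identity j M a))))))
    where
    identity : ∀ j M a → j + suc (suc (j + M + a)) + 2 ≡ suc (suc (j + M + j)) + suc (suc a)
    identity = solve-∀

  value-end : ∀ {a} → a ≡ j → value (suc (j + M + a)) ≡ N
  value-end refl = trans (if-false (>⇒≤ᵇ≡false (j+1< (s≤s (s≤s (≤-trans (m≤m+n j M) (m≤m+n (j + M) j)))))))
    (trans (if-false (>⇒≤ᵇ≡false (subst (_< suc (suc (j + M + j))) (sym (cong (_∸ 1) 2n∸j))
      (s≤s (s≤s (m≤m+n (j + M) j))))))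
    (trans (if-false (>⇒≤ᵇ≡false (subst (_< suc (suc (j + M + j))) (sym (cong (_∸ 1) 2n≡N)) ≤-refl)))
      2n≡N))

  value-range : ∀ k → k < N → 1 ≤ value k × value k ≤ N
  value-range zero _ = s≤s z≤n , s≤s z≤n
  value-range (suc k) k<N with region (suc k) k<N
  ... | first a e = subst (λ v → 1 ≤ v × v ≤ N) (sym (value-first k e))
        (s≤s z≤n , last<N (trans (+-suc k a) e))
  ... | middle a b refl e = subst (λ v → 1 ≤ v × v ≤ N) (sym (value-middle e)) (s≤s z≤n , middle<N e)
  ... | last a zero refl e = subst (λ v → 1 ≤ v × v ≤ N) (sym (value-end (trans (sym (+-identityʳ a)) e)))
        (s≤s z≤n , ≤-refl)
  ... | last a (suc b) refl e = subst (λ v → 1 ≤ v × v ≤ N) (sym (value-last e))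
        (s≤s z≤n , first<N (suc a) (trans (sym (+-suc a b)) e))

  position : ℕ → ℕ
  position v = if v ≤ᵇ 1 then 0 else if v ≤ᵇ suc j then v + (j + M) ∸ 1
               else if v ≤ᵇ suc (j + M) then v ∸ 1
               else if v ≤ᵇ suc (j + M + j) then v ∸ suc (j + M) else suc (j + M + j)

  position-value : ∀ k → k < N → position (value k) ≡ k
  position-value zero _ = refl
  position-value (suc k) k<N with region (suc k) k<N
  ... | first a e = trans (cong position (value-first k e))
        (trans (if-false (>⇒≤ᵇ≡false (s≤s (s≤s (≤-trans (m≤m+n j M) (m≤m+n (j + M) k))))))
        (trans (if-false (>⇒≤ᵇ≡false (s≤s (s≤s (m≤m+n (j + M) k)))))
        (trans (if-true (≤⇒≤ᵇ≡true (s≤s (subst (_≤ j + M + j) (+-suc (j + M) k) (j+M+a≤j+M+j e)))))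
          (+-∸-inverse (suc (j + M)) (cong suc (+-suc (j + M) k))))))
  ... | middle a b refl e = trans (cong position (value-middle e))
        (trans (if-false (>⇒≤ᵇ≡false (s≤s (s≤s (m≤m+n j a)))))
        (if-true (≤⇒≤ᵇ≡true (s≤s (subst (_≤ j + M) (+-suc j a)
          (+-monoʳ-≤ j (subst (suc a ≤_) e (s≤s (m≤m+n a b)))))))))
  ... | last a zero refl e = trans (cong position (value-end j≡a))
        (trans (if-false (>⇒≤ᵇ≡false (s≤s (s≤s (≤-trans (m≤m+n j M) (m≤m+n (j + M) j))))))
        (trans (if-false (>⇒≤ᵇ≡false (s≤s (s≤s (m≤m+n (j + M) j)))))
        (trans (if-false (>⇒≤ᵇ≡false {suc (suc (j + M + j))} {suc (j + M + j)} ≤-refl))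
          (cong (λ a → suc (j + M + a)) (sym j≡a)))))
    where
    j≡a : a ≡ j
    j≡a = trans (sym (+-identityʳ a)) e
  ... | last a (suc b) refl e = trans (cong position (value-last e))
        (trans (if-true (≤⇒≤ᵇ≡true (s≤s (subst (_≤ j) (+-comm a 1) (subst (a + 1 ≤_) e (+-monoʳ-≤ a (s≤s z≤n)))))))
          (cong suc (+-comm a (j + M))))

  value-injective : ∀ k k′ → k < N → k′ < N → value k ≡ value k′ → k ≡ k′
  value-injective k k′ k<N k′<N e =
    trans (sym (position-value k k<N)) (trans (cong position e) (position-value k′ k′<N))

  value-first+last : ∀ k {a} → k + a ≡ j → value k + value (suc (j + M + a)) ≡ suc N
  value-first+last zero e = cong suc (value-end e)
  value-first+last (suc k) {a} e =
    trans (cong₂ _+_ (value-first k e) (value-last (trans (+-comm a (suc k)) e)))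
      (trans (identity j M k a) (cong (λ s → suc (suc (suc (j + M + s)))) e))
    where
    identity : ∀ j M k a → suc (suc (j + M + k)) + suc (suc a) ≡ suc (suc (suc (j + M + (suc k + a))))
    identity = solve-∀

  value-symmetric : ∀ k k′ → k < N → suc (k + k′) ≡ N → value k + value k′ ≡ suc N
  value-symmetric k k′ k<N mirror with region k k<N
  ... | first a e = trans (cong (λ k″ → value k + value k″) (mirror-first k e mirror)) (value-first+last k e)
  ... | middle a b refl e = trans (cong (λ k″ → value k + value k″) (mirror-middle e mirror))
        (trans (cong₂ _+_ (value-middle e) (value-middle (trans (cong suc (+-comm b a)) e)))
          (trans (identity j a b) (cong (λ s → suc (suc (suc (j + s + j)))) e)))
    where
    identity : ∀ j a b → suc (suc (j + a)) + suc (suc (j + b)) ≡ suc (suc (suc (j + suc (a + b) + j)))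
    identity = solve-∀
  ... | last a b refl e = trans (cong (λ k″ → value k + value k″) (mirror-last e mirror))
        (trans (+-comm (value k) (value b)) (value-first+last b (trans (+-comm b a) e)))

  private
    run≡0⇒≤j : ∀ {k} → run k ≡ 0 → k ≤ j
    run≡0⇒≤j {k} run≡0 with k ≤ᵇ j in e
    ... | true = ≤ᵇ⇒≤ k j (subst T (sym e) _)
    ... | false with k ≤ᵇ j + M
    ...   | true = ⊥-elim (1+n≢0 run≡0)
    ...   | false = ⊥-elim (1+n≢0 run≡0)

    middle-end+1 : ∀ {a} → suc (a + 0) ≡ M → suc (suc (j + a)) ≡ suc (j + M + 0)
    middle-end+1 {a} e = cong suc (trans (sym (+-suc j a))
      (trans (sym (+-identityʳ (j + suc a))) (cong (λ s → j + s + 0) (trans (cong suc (sym (+-identityʳ a))) e))))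

    last-next : ∀ a → suc (suc (j + M + a)) ≡ suc (j + M + suc a)
    last-next a = cong suc (sym (+-suc (j + M) a))

    last-end-not-next : ∀ {a} → a + 0 ≡ j → ¬ suc (suc (j + M + a)) < N
    last-end-not-next {a} e = <-irrefl (cong (λ s → suc (suc (j + M + s))) (trans (sym (+-identityʳ a)) e))

  value-ascending : ∀ k → suc k < N → run k ≡ run (suc k) → value k < value (suc k)
  value-ascending k k+1<N same with region k (<-trans (n<1+n k) k+1<N)
  ... | first zero e = ⊥-elim (<-irrefl (trans (sym (+-identityʳ k)) e)
        (run≡0⇒≤j (trans (sym same) (run-first k e))))
  value-ascending zero _ _ | first (suc a) e = subst (1 <_) (sym (value-first 0 e)) (s≤s (s≤s z≤n))
  value-ascending (suc k) _ _ | first (suc a) e =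
    subst₂ _<_ (sym (value-first k e))
      (sym (value-first (suc k) (trans (sym (+-suc (suc k) a)) e)))
      (s≤s (s≤s (≤-reflexive (sym (+-suc (j + M) k)))))
  ... | middle a zero refl e = ⊥-elim (1+n≢n {1} (trans (sym (run-last 0))
        (trans (cong run (sym (middle-end+1 e))) (trans (sym same) (run-middle e)))))
  ... | middle a (suc b) refl e = subst₂ _<_ (sym (value-middle e))
        (sym (trans (cong value (cong suc (sym (+-suc j a))))
          (trans (value-middle (trans (cong suc (sym (+-suc a b))) e)) (cong suc (cong suc (+-suc j a))))))
        ≤-refl
  ... | last a zero refl e = ⊥-elim (last-end-not-next e k+1<N)
  ... | last a (suc zero) refl e = subst₂ _<_ (sym (value-last e))
        (sym (trans (cong value (last-next a)) (value-end (trans (+-comm 1 a) e))))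
        (s≤s (s≤s (≤-trans (subst (suc a ≤_) e (≤-reflexive (+-comm 1 a)))
          (≤-trans (m≤m+n j (M + j)) (≤-reflexive (sym (+-assoc j M j)))))))
  ... | last a (suc (suc b)) refl e = subst₂ _<_ (sym (value-last e))
        (sym (trans (cong value (last-next a)) (value-last (trans (sym (+-suc a (suc b))) e))))
        ≤-refl

  value-between-runs : ∀ k → suc k < N → run k ≢ run (suc k) → value (rev k) ≡ 1 ⊎ value (rev (suc k)) ≡ N
  value-between-runs k k+1<N differ with region k (<-trans (n<1+n k) k+1<N)
  ... | first zero e = inj₁ (cong value (rev-first k e))
  ... | first (suc a) e = ⊥-elim (differ (trans (run-first k e) (sym (run-first (suc k) (trans (sym (+-suc k a)) e)))))
  ... | middle a zero refl e = inj₂ (trans (cong (value ∘ rev) (middle-end+1 e))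
        (trans (cong value (rev-last refl)) (value-end refl)))
  ... | middle a (suc b) refl e = ⊥-elim (differ (trans (run-middle e)
        (sym (trans (cong run (cong suc (sym (+-suc j a)))) (run-middle (trans (cong suc (sym (+-suc a b))) e))))))
  ... | last a zero refl e = ⊥-elim (last-end-not-next e k+1<N)
  ... | last a (suc b) refl e =
        ⊥-elim (differ (trans (run-last a) (sym (trans (cong run (last-next a)) (run-last (suc a))))))

  private
    Pos : Set
    Pos = Fin (2 * n)

    toℕ<N : (p : Pos) → toℕ p < N
    toℕ<N p = subst (toℕ p <_) 2n≡N (Fin.toℕ<n p)

  open Words n using (toℕ<⇒≢; toℕ-opposite-sum; value1-<; <-valueN)

  xPerm-IsB : IsB n (xPerm n j)
  xPerm-IsB = (range , λ p q e → Fin.toℕ-injective (value-injective (toℕ p) (toℕ q) (toℕ<N p) (toℕ<N q) e)) ,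
    λ p → trans (value-symmetric (toℕ p) (toℕ (opposite p)) (toℕ<N p) (trans (toℕ-opposite-sum p) 2n≡N))
                (cong suc (sym 2n≡N))
    where
    range : ∀ p → 1 ≤ xPerm n j p × xPerm n j p ≤ 2 * n
    range p with value-range (toℕ p) (toℕ<N p)
    ... | 1≤v , v≤N = 1≤v , subst (value (toℕ p) ≤_) (sym 2n≡N) v≤N

  abstract
    ρ : Pos → Pos
    ρ p = fromℕ< (subst (rev (toℕ p) <_) (sym 2n≡N) (rev<N (toℕ p) (toℕ<N p)))

    toℕ-ρ : ∀ p → toℕ (ρ p) ≡ rev (toℕ p)
    toℕ-ρ p = Fin.toℕ-fromℕ< _

  ρ-involutive : ∀ p → ρ (ρ p) ≡ p
  ρ-involutive p = Fin.toℕ-injective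
    (trans (toℕ-ρ (ρ p)) (trans (cong rev (toℕ-ρ p)) (rev-involutive (toℕ p) (toℕ<N p))))

  ρ-opposite : ∀ p → ρ (opposite p) ≡ opposite (ρ p)
  ρ-opposite p = Fin.toℕ-injective (trans (toℕ-ρ (opposite p))
    (complement-unique (rev (toℕ p))
      (rev-mirror (toℕ p) (toℕ (opposite p)) (toℕ<N p) (trans (toℕ-opposite-sum p) 2n≡N))
      (subst (λ r → suc (r + toℕ (opposite (ρ p))) ≡ N) (toℕ-ρ p) (trans (toℕ-opposite-sum (ρ p)) 2n≡N))))

  ρ-adjacent-≢ : ∀ {p q} → toℕ q ≡ suc (toℕ p) → ρ p ≢ ρ q
  ρ-adjacent-≢ {p} {q} q≡p+1 e = toℕ<⇒≢ (≤-reflexive (sym q≡p+1))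
    (trans (sym (ρ-involutive p)) (trans (cong ρ e) (ρ-involutive q)))

  xPerm-RunReversal : RunReversal n (xPerm n j)
  xPerm-RunReversal = record
    { ρ = ρ
    ; ρ-involutive = ρ-involutive
    ; ρ-opposite = ρ-opposite
    ; run = run ∘ toℕ
    ; run-monotone = run-monotone
    ; run-ρ = λ p → trans (cong run (toℕ-ρ p)) (run-rev (toℕ p) (toℕ<N p))
    ; ρ-reverses-runs = λ {p} {q} same → trans (cong (_+ toℕ p) (toℕ-ρ p)) (trans (rev+id (toℕ p) (toℕ<N p))
        (trans (cong runSum same) (sym (trans (cong (_+ toℕ q) (toℕ-ρ q)) (rev+id (toℕ q) (toℕ<N q))))))
    ; ascending-in-runs = λ {p} {q} q≡p+1 same → subst (value (toℕ p) <_) (cong value (sym q≡p+1))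
        (value-ascending (toℕ p) (subst (_< N) q≡p+1 (toℕ<N q)) (trans same (cong run q≡p+1)))
    ; ascending-between-runs = between
    }
    where
    between : ∀ {p q} → toℕ q ≡ suc (toℕ p) → run (toℕ p) ≢ run (toℕ q) → xPerm n j (ρ p) < xPerm n j (ρ q)
    between {p} {q} q≡p+1 differ with value-between-runs (toℕ p) (subst (_< N) q≡p+1 (toℕ<N q))
                                        (λ same → differ (trans same (cong run (sym q≡p+1))))
    ... | inj₁ at1 = value1-< (proj₁ xPerm-IsB) (trans (cong value (toℕ-ρ p)) at1) (ρ-adjacent-≢ q≡p+1)
    ... | inj₂ atN = <-valueN (proj₁ xPerm-IsB)
          (trans (cong value (trans (toℕ-ρ q) (cong rev q≡p+1))) (trans atN (sym 2n≡N))) (ρ-adjacent-≢ q≡p+1)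

mainTheorem5 : (n j : ℕ) → 2 ≤ n → 1 ≤ j → j ≤ n ∸ 1 → InPopImage n (xPerm n j)
mainTheorem5 (suc n′) j _ _ j≤n′ with ≤⇒∃+ j≤n′
... | m , refl = InPopImage-of-RunReversal
  where open PopOfRunReversal (Witness.xPerm-IsB j m) (Witness.xPerm-RunReversal j m)
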